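{- For all $n,b\in\mathbb{N}$, \[ \sum_{\ell=0}^{2b}w(n,\ell+1)\equiv1\pmod{2}\qquad\text{and}\qquad \sum_{\ell=0}^{2b}H(n,\ell)\equiv 0\pmod{2}. \]
   Context: For $n\in\mathbb{N}$ and $\ell\in\mathbb{Z}^+$, $w(n,\ell)=\frac{1}{\ell}\binom{n-1}{\ell-1}\binom{n+\ell}{\ell-1}=\binom{n-1}{\ell-1}\binom{n+\ell}{\ell}-\binom{n}{\ell}\binom{n+\ell}{\ell-1}\in\mathbb{Z}$, where $\binom{x}{r}=x(x-1)\cdots(x-r+1)/r!$ for integers $r\ge0$. Also $H(n,\ell)=w(n,\ell+1)+w(n+1,\ell+1)$ for $\ell\in\mathbb{N}$. -}

module Defs where

open import Data.Nat as ℕ using (ℕ; zero; suc; _!)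
open import Data.Nat.Properties using (_!≢0)
open import Data.Integer using (ℤ; +_; _+_; _-_; _*_)
open import Data.Integer.DivMod using (_/ℕ_)

falling : ℤ → ℕ → ℤ
falling x zero    = + 1
falling x (suc r) = falling x r * (x - + r)

-- generalized binomial coefficient  binom x r = x(x-1)...(x-r+1)/r!
-- (exact division; the quotient is an integer)
binom : ℤ → ℕ → ℤ
binom x r = (falling x r /ℕ (r !)) {{r !≢0}}

-- w(n, ℓ+1) = C(n-1, ℓ) C(n+ℓ+1, ℓ+1) - C(n, ℓ+1) C(n+ℓ+1, ℓ)
-- i.e. w is indexed by ℓ' = ℓ + 1 ∈ ℤ⁺ (w1 n ℓ denotes w(n, ℓ+1)).
w1 : ℕ → ℕ → ℤ
w1 n ℓ = binom (+ n - + 1) ℓ * binom (+ (n ℕ.+ suc ℓ)) (suc ℓ)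
       - binom (+ n) (suc ℓ) * binom (+ (n ℕ.+ suc ℓ)) ℓ

H : ℕ → ℕ → ℤ
H n ℓ = w1 n ℓ + w1 (suc n) ℓ

sumTo : ℕ → (ℕ → ℤ) → ℤ
sumTo zero    f = f zero
sumTo (suc m) f = sumTo m f + f (suc m)

module Submission where

-- For n ≥ 1 the closed form ℓ·w(n,ℓ) = C(n-1,ℓ-1)·C(n+ℓ,ℓ-1) and the absorption identities give
--   (ℓ+1)·(w(n,ℓ) + w(n,ℓ+1)) = C(n,ℓ)·C(n+ℓ,ℓ) = C(n+ℓ,2ℓ)·C(2ℓ,ℓ),
-- which is even since C(2ℓ,ℓ) is. For even ℓ the factor ℓ+1 is odd, so w(n,ℓ) + w(n,ℓ+1) is even, and as
-- w(n,1) = 1 the sum of w(n,ℓ) over 1 ≤ ℓ ≤ 2b+1 is odd. For n = 0, w(0,ℓ) = (-1)^(ℓ-1) and the pairs cancel.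
-- Adding the statements for n and n+1 gives the one for H.

open import Defs

module BinomialCoefficients where

  open import Data.Nat
  open import Data.Nat.Combinatorics
  open import Data.Nat.Divisibility using (_∣_; divides; _∣0; ∣n⇒∣m*n)
  open import Data.Nat.DivMod using (m/n*n≡m)
  open import Data.Nat.Properties
  open import Algebra.Properties.CommutativeSemigroup +-commutativeSemigroup using (xy∙z≈xz∙y)
  open import Data.Nat.Tactic.RingSolver using (solve-∀)
  open import Data.Product using (_,_)
  open import Relation.Binary.PropositionalEquality
  open import Relation.Nullary using (yes; no)
  open ≡-Reasoning

  nC0≡1 : ∀ n → n C 0 ≡ 1
  nC0≡1 n = begin
    n C 0       ≡⟨ cong (n C_) (n∸n≡0 n) ⟨
    n C (n ∸ n) ≡⟨ nCk≡nC[n∸k] (≤-refl {n}) ⟨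
    n C n       ≡⟨ nCn≡1 n ⟩
    1           ∎

  [k+1]*[n+1]C[k+1]≡[n+1]*nCk : ∀ n k → suc k * (suc n C suc k) ≡ suc n * (n C k)
  [k+1]*[n+1]C[k+1]≡[n+1]*nCk zero    zero    = refl
  [k+1]*[n+1]C[k+1]≡[n+1]*nCk zero    (suc k) = *-zeroʳ (2 + k)
  [k+1]*[n+1]C[k+1]≡[n+1]*nCk (suc n) zero    = begin
    1 * ((2 + n) C 1) ≡⟨ *-identityˡ _ ⟩
    (2 + n) C 1       ≡⟨ nC1≡n (2 + n) ⟩
    2 + n             ≡⟨ *-identityʳ (2 + n) ⟨
    (2 + n) * 1       ∎
  [k+1]*[n+1]C[k+1]≡[n+1]*nCk (suc n) (suc k) = begin
    (2 + k) * ((2 + n) C (2 + k))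
      ≡⟨ cong ((2 + k) *_) (nCk+nC[k+1]≡[n+1]C[k+1] (suc n) (suc k)) ⟨
    (2 + k) * (x + y)
      ≡⟨ *-distribˡ-+ (2 + k) x y ⟩
    x + (1 + k) * x + (2 + k) * y
      ≡⟨ cong₂ (λ u v → x + u + v) ([k+1]*[n+1]C[k+1]≡[n+1]*nCk n k)
                                   ([k+1]*[n+1]C[k+1]≡[n+1]*nCk n (suc k)) ⟩
    x + (1 + n) * (n C k) + (1 + n) * (n C suc k)
      ≡⟨ +-assoc x _ _ ⟩
    x + ((1 + n) * (n C k) + (1 + n) * (n C suc k))
      ≡⟨ cong (x +_) (*-distribˡ-+ (1 + n) (n C k) (n C suc k)) ⟨
    x + (1 + n) * (n C k + n C suc k)
      ≡⟨ cong (λ u → x + (1 + n) * u) (nCk+nC[k+1]≡[n+1]C[k+1] n k) ⟩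
    (2 + n) * x ∎
    where
    x = (1 + n) C (1 + k)
    y = (1 + n) C (2 + k)

  [k+1]*nC[k+1]+k*nCk≡n*nCk : ∀ n k → suc k * (n C suc k) + k * (n C k) ≡ n * (n C k)
  [k+1]*nC[k+1]+k*nCk≡n*nCk zero    zero    = refl
  [k+1]*nC[k+1]+k*nCk≡n*nCk zero    (suc k) = cong₂ _+_ (*-zeroʳ (2 + k)) (*-zeroʳ (1 + k))
  [k+1]*nC[k+1]+k*nCk≡n*nCk (suc n) zero    = begin
    1 * ((1 + n) C 1) + 0 ≡⟨ +-identityʳ _ ⟩
    1 * ((1 + n) C 1)     ≡⟨ *-identityˡ _ ⟩
    (1 + n) C 1           ≡⟨ nC1≡n (1 + n) ⟩
    1 + n                 ≡⟨ *-identityʳ (1 + n) ⟨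
    (1 + n) * 1           ∎
  [k+1]*nC[k+1]+k*nCk≡n*nCk (suc n) (suc k) = begin
    (2 + k) * ((1 + n) C (2 + k)) + (1 + k) * ((1 + n) C (1 + k))
      ≡⟨ cong₂ _+_ ([k+1]*[n+1]C[k+1]≡[n+1]*nCk n (suc k)) ([k+1]*[n+1]C[k+1]≡[n+1]*nCk n k) ⟩
    (1 + n) * (n C suc k) + (1 + n) * (n C k)
      ≡⟨ *-distribˡ-+ (1 + n) (n C suc k) (n C k) ⟨
    (1 + n) * (n C suc k + n C k)
      ≡⟨ cong ((1 + n) *_) (trans (+-comm (n C suc k) (n C k)) (nCk+nC[k+1]≡[n+1]C[k+1] n k)) ⟩
    (1 + n) * ((1 + n) C (1 + k)) ∎

  [k+1]*[n+k+1]C[k+1]≡[n+1]*[n+k+1]Ck : ∀ n k →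
    suc k * ((n + suc k) C suc k) ≡ suc n * ((n + suc k) C k)
  [k+1]*[n+k+1]C[k+1]≡[n+1]*[n+k+1]Ck n k = +-cancelʳ-≡ (k * x) _ _ (begin
    suc k * (N C suc k) + k * x ≡⟨ [k+1]*nC[k+1]+k*nCk≡n*nCk N k ⟩
    N * x                       ≡⟨ cong (_* x) (+-suc n k) ⟩
    (suc n + k) * x             ≡⟨ *-distribʳ-+ x (suc n) k ⟩
    suc n * x + k * x           ∎)
    where
    N = n + suc k
    x = N C k

  [k+d]Ck*[k!*d!]≡[k+d]! : ∀ k d → ((k + d) C k) * (k ! * d !) ≡ (k + d) !
  [k+d]Ck*[k!*d!]≡[k+d]! k d = begin
    ((k + d) C k) * (k ! * d !)
      ≡⟨ cong (λ e → ((k + d) C k) * (k ! * e !)) (m+n∸m≡n k d) ⟨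
    ((k + d) C k) * (k ! * (k + d ∸ k) !)
      ≡⟨ cong (_* (k ! * (k + d ∸ k) !)) (nCk≡n!/k![n-k]! k≤k+d) ⟩
    (k + d) ! / (k ! * (k + d ∸ k) !) * (k ! * (k + d ∸ k) !)
      ≡⟨ m/n*n≡m (k![n∸k]!∣n! k≤k+d) ⟩
    (k + d) ! ∎
    where
    k≤k+d = m≤m+n k d
    instance _ = k !* (k + d ∸ k) !≢0

  [c+d+e]C[c+d]*[c+d]Cc≡[c+d+e]Cc*[d+e]Cd : ∀ c d e →
    ((c + d + e) C (c + d)) * ((c + d) C c) ≡ ((c + d + e) C c) * ((d + e) C d)
  [c+d+e]C[c+d]*[c+d]Cc≡[c+d+e]Cc*[d+e]Cd c d e =
    *-cancelʳ-≡ _ _ (c ! * d ! * e !) {{m*n≢0 _ _ {{c !* d !≢0}} {{e !≢0}}}}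
      (trans choose-c+d-first (sym choose-c-first))
    where
    X = (c + d + e) C (c + d)
    Y = (c + d) C c
    Z = (c + d + e) C c
    W = (d + e) C d
    F = [k+d]Ck*[k!*d!]≡[k+d]!

    choose-c+d-first : X * Y * (c ! * d ! * e !) ≡ (c + d + e) !
    choose-c+d-first = begin
      X * Y * (c ! * d ! * e !)   ≡⟨ regroup X Y (c !) (d !) (e !) ⟩
      X * (Y * (c ! * d !)) * e ! ≡⟨ cong (λ t → X * t * e !) (F c d) ⟩
      X * (c + d) ! * e !         ≡⟨ *-assoc X _ _ ⟩
      X * ((c + d) ! * e !)       ≡⟨ F (c + d) e ⟩
      (c + d + e) !               ∎
      where
      regroup : ∀ x y a b e → x * y * (a * b * e) ≡ x * (y * (a * b)) * e
      regroup = solve-∀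

    choose-c-first : Z * W * (c ! * d ! * e !) ≡ (c + d + e) !
    choose-c-first = begin
      Z * W * (c ! * d ! * e !)               ≡⟨ regroup Z W (c !) (d !) (e !) ⟩
      Z * (c ! * (W * (d ! * e !)))           ≡⟨ cong (λ t → Z * (c ! * t)) (F d e) ⟩
      Z * (c ! * (d + e) !)                   ≡⟨ cong (λ a → (a C c) * (c ! * (d + e) !)) (+-assoc c d e) ⟩
      ((c + (d + e)) C c) * (c ! * (d + e) !) ≡⟨ F c (d + e) ⟩
      (c + (d + e)) !                         ≡⟨ cong _! (+-assoc c d e) ⟨
      (c + d + e) !                           ∎
      where
      regroup : ∀ z w a b e → z * w * (a * b * e) ≡ z * (a * (w * (b * e)))
      regroup = solve-∀

  2∣[2k+2]C[k+1] : ∀ k → 2 ∣ (suc k + suc k) C suc k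
  2∣[2k+2]C[k+1] k = divides x (begin
    (suc k + suc k) C suc k ≡⟨ nCk+nC[k+1]≡[n+1]C[k+1] N k ⟨
    x + N C suc k           ≡⟨ cong (x +_) symmetric ⟩
    x + x                   ≡⟨ cong (x +_) (+-identityʳ x) ⟨
    2 * x                   ≡⟨ *-comm 2 x ⟩
    x * 2                   ∎)
    where
    N = k + suc k
    x = N C k
    symmetric : N C suc k ≡ x
    symmetric = trans (nCk≡nC[n∸k] (m≤n+m (suc k) k)) (cong (N C_) (m+n∸n≡m k (suc k)))

  2∣nC[k+1]*[n+k+1]C[k+1] : ∀ n k → 2 ∣ (n C suc k) * ((n + suc k) C suc k)
  2∣nC[k+1]*[n+k+1]C[k+1] n k with suc k ≤? n
  ... | no  k+1≰n =
    subst (λ x → 2 ∣ x * ((n + suc k) C suc k)) (sym (k>n⇒nCk≡0 (≰⇒> k+1≰n))) (2 ∣0)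
  ... | yes k+1≤n with m≤n⇒∃[o]m+o≡n k+1≤n
  ...   | e , refl = subst (2 ∣_) revision (∣n⇒∣m*n ((L + L + e) C (L + L)) (2∣[2k+2]C[k+1] k))
    where
    L = suc k
    revision : ((L + L + e) C (L + L)) * ((L + L) C L) ≡ ((L + e) C L) * ((L + e + L) C L)
    revision = begin
      ((L + L + e) C (L + L)) * ((L + L) C L) ≡⟨ [c+d+e]C[c+d]*[c+d]Cc≡[c+d+e]Cc*[d+e]Cd L L e ⟩
      ((L + L + e) C L) * ((L + e) C L)       ≡⟨ *-comm ((L + L + e) C L) _ ⟩
      ((L + e) C L) * ((L + L + e) C L)       ≡⟨ cong (λ a → ((L + e) C L) * (a C L)) (xy∙z≈xz∙y L L e) ⟩
      ((L + e) C L) * ((L + e + L) C L)       ∎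

  -- (k+1)·w(m+1,k+1), by the closed form w(n,ℓ) = C(n-1,ℓ-1)·C(n+ℓ,ℓ-1)/ℓ
  wNumerator : ℕ → ℕ → ℕ
  wNumerator m k = (m C k) * ((suc m + suc k) C k)

  wNumerator-split : ∀ m k → let N = suc m + suc k in
    suc k * ((m C k) * (N C suc k)) ≡ suc k * ((suc m C suc k) * (N C k)) + wNumerator m k
  wNumerator-split m k = begin
    suc k * (p * (N C suc k))              ≡⟨ x*[y*z]≡y*[x*z] (suc k) p _ ⟩
    p * (suc k * (N C suc k))              ≡⟨ cong (p *_) ([k+1]*[n+k+1]C[k+1]≡[n+1]*[n+k+1]Ck (suc m) k) ⟩
    p * ((2 + m) * q)                      ≡⟨ regroup m p q ⟩
    (suc m * p) * q + p * q                ≡⟨ cong (λ x → x * q + p * q) ([k+1]*[n+1]C[k+1]≡[n+1]*nCk m k) ⟨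
    (suc k * (suc m C suc k)) * q + p * q  ≡⟨ cong (_+ p * q) (*-assoc (suc k) (suc m C suc k) q) ⟩
    suc k * ((suc m C suc k) * q) + p * q  ∎
    where
    N = suc m + suc k
    p = m C k
    q = N C k
    x*[y*z]≡y*[x*z] : ∀ x y z → x * (y * z) ≡ y * (x * z)
    x*[y*z]≡y*[x*z] = solve-∀
    regroup : ∀ m p q → p * ((2 + m) * q) ≡ (suc m * p) * q + p * q
    regroup = solve-∀

  -- The identity (j+1)(j+2) + (m-j)(m+j+3) = (m+1)(m+2), with (m-j)p written as a so as to stay in ℕ.
  wNumerator-pair-core : ∀ m j p q a → a + j * p ≡ m * p →
    (1 + j) * (2 + j) * (p * q) + a * (suc (suc m + suc j) * q) ≡ (suc m * p) * ((2 + m) * q)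
  wNumerator-pair-core m j p q a a+jp≡mp = +-cancelʳ-≡ (j * p * ((3 + m + j) * q)) _ _ (begin
    (1 + j) * (2 + j) * (p * q) + a * (suc (suc m + suc j) * q) + j * p * ((3 + m + j) * q)
      ≡⟨ collect m j p q a ⟩
    (1 + j) * (2 + j) * (p * q) + (a + j * p) * ((3 + m + j) * q)
      ≡⟨ cong (λ x → (1 + j) * (2 + j) * (p * q) + x * ((3 + m + j) * q)) a+jp≡mp ⟩
    (1 + j) * (2 + j) * (p * q) + m * p * ((3 + m + j) * q)
      ≡⟨ expand m j p q ⟩
    (suc m * p) * ((2 + m) * q) + j * p * ((3 + m + j) * q) ∎)
    where
    collect : ∀ m j p q a → (1 + j) * (2 + j) * (p * q) + a * (suc (suc m + suc j) * q) + j * p * ((3 + m + j) * q)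
                          ≡ (1 + j) * (2 + j) * (p * q) + (a + j * p) * ((3 + m + j) * q)
    collect = solve-∀
    expand : ∀ m j p q → (1 + j) * (2 + j) * (p * q) + m * p * ((3 + m + j) * q)
                       ≡ (suc m * p) * ((2 + m) * q) + j * p * ((3 + m + j) * q)
    expand = solve-∀

  wNumerator-pair : ∀ m j →
    (2 + j) * wNumerator m j + (1 + j) * wNumerator m (suc j)
      ≡ (1 + j) * ((suc m C suc j) * ((suc m + suc j) C suc j))
  wNumerator-pair m j = *-cancelˡ-≡ _ _ (suc j) (begin
    suc j * ((2 + j) * (p * q) + (1 + j) * (a * b))
      ≡⟨ distribute j p q a b ⟩
    (1 + j) * (2 + j) * (p * q) + (suc j * a) * (suc j * b)
      ≡⟨ cong (λ x → (1 + j) * (2 + j) * (p * q) + (suc j * a) * x) b-absorbed ⟩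
    (1 + j) * (2 + j) * (p * q) + (suc j * a) * (suc N * q)
      ≡⟨ wNumerator-pair-core m j p q (suc j * a) ([k+1]*nC[k+1]+k*nCk≡n*nCk m j) ⟩
    (suc m * p) * ((2 + m) * q)
      ≡⟨ cong₂ _*_ ([k+1]*[n+1]C[k+1]≡[n+1]*nCk m j) ([k+1]*[n+k+1]C[k+1]≡[n+1]*[n+k+1]Ck (suc m) j) ⟨
    (suc j * (suc m C suc j)) * (suc j * (N C suc j))
      ≡⟨ distribute′ j (suc m C suc j) (N C suc j) ⟩
    suc j * ((1 + j) * ((suc m C suc j) * (N C suc j))) ∎)
    where
    N = suc m + suc j
    p = m C j
    q = N C j
    a = m C suc j
    b = (suc m + suc (suc j)) C suc j
    b-absorbed : suc j * b ≡ suc N * q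
    b-absorbed = trans (cong (λ x → suc j * (x C suc j)) (+-suc (suc m) (suc j)))
                       ([k+1]*[n+1]C[k+1]≡[n+1]*nCk N j)
    distribute : ∀ j p q a b → suc j * ((2 + j) * (p * q) + (1 + j) * (a * b))
                             ≡ (1 + j) * (2 + j) * (p * q) + (suc j * a) * (suc j * b)
    distribute = solve-∀
    distribute′ : ∀ j c d → (suc j * c) * (suc j * d) ≡ suc j * ((1 + j) * (c * d))
    distribute′ = solve-∀

open import Data.Integer hiding (suc)
open import Data.Integer.DivMod using (_/ℕ_; _%ℕ_; a≡a%ℕn+[a/ℕn]*n; n%ℕd<d)
import Data.Integer.Divisibility as Unsigned
open import Data.Integer.Divisibility.Signed
open import Data.Integer.Properties
open import Data.Integer.Tactic.RingSolver using (solve-∀)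
open import Data.Nat as ℕ using (ℕ; zero; suc)
open import Data.Nat.Combinatorics using (_C_; nCn≡1)
import Data.Nat.Properties as ℕ
open import Data.Product using (_×_; _,_)
open import Relation.Binary.PropositionalEquality
open ≡-Reasoning
open BinomialCoefficients

i*n/ℕn≡i : ∀ i n .{{_ : ℕ.NonZero n}} → (i * + n) /ℕ n ≡ i
i*n/ℕn≡i i n = sym (i-j≡0⇒i≡j i q (∣i∣≡0⇒i≡0 (ℕ.n<1⇒n≡0 ∣i-q∣<1)))
  where
  q = (i * + n) /ℕ n
  r = (i * + n) %ℕ n
  ∣i-q∣*n≡r : ∣ i - q ∣ ℕ.* n ≡ r
  ∣i-q∣*n≡r = begin
    ∣ i - q ∣ ℕ.* n             ≡⟨ abs-* (i - q) (+ n) ⟨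
    ∣ (i - q) * + n ∣           ≡⟨ cong ∣_∣ (distrib i q (+ n)) ⟩
    ∣ i * + n - q * + n ∣       ≡⟨ cong (λ x → ∣ x - q * + n ∣) (a≡a%ℕn+[a/ℕn]*n (i * + n) n) ⟩
    ∣ + r + q * + n - q * + n ∣ ≡⟨ cong ∣_∣ (cancel (+ r) (q * + n)) ⟩
    r                           ∎
    where
    distrib : ∀ i q n → (i - q) * n ≡ i * n - q * n
    distrib = solve-∀
    cancel : ∀ r x → r + x - x ≡ r
    cancel = solve-∀
  ∣i-q∣<1 : ∣ i - q ∣ ℕ.< 1
  ∣i-q∣<1 = ℕ.*-cancelʳ-< n ∣ i - q ∣ 1
    (subst₂ ℕ._<_ (sym ∣i-q∣*n≡r) (sym (ℕ.*-identityˡ n)) (n%ℕd<d (i * + n) n))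

[n-k]*nCk≡[k+1]*nC[k+1] : ∀ n k → (+ n - + k) * + (n C k) ≡ + suc k * + (n C suc k)
[n-k]*nCk≡[k+1]*nC[k+1] n k = begin
  (+ n - + k) * + c                            ≡⟨ distrib (+ n) (+ k) (+ c) ⟩
  + n * + c - + k * + c                        ≡⟨ cong₂ _-_ (pos-* n c) (pos-* k c) ⟨
  + (n ℕ.* c) - + (k ℕ.* c)                    ≡⟨ cong (λ x → + x - + (k ℕ.* c)) ([k+1]*nC[k+1]+k*nCk≡n*nCk n k) ⟨
  + (suc k ℕ.* a ℕ.+ k ℕ.* c) - + (k ℕ.* c)    ≡⟨ cong (_- + (k ℕ.* c)) (pos-+ (suc k ℕ.* a) (k ℕ.* c)) ⟩
  + (suc k ℕ.* a) + + (k ℕ.* c) - + (k ℕ.* c)  ≡⟨ cancel (+ (suc k ℕ.* a)) (+ (k ℕ.* c)) ⟩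
  + (suc k ℕ.* a)                              ≡⟨ pos-* (suc k) a ⟩
  + suc k * + a                                ∎
  where
  a = n C suc k
  c = n C k
  distrib : ∀ n k c → (n - k) * c ≡ n * c - k * c
  distrib = solve-∀
  cancel : ∀ x y → x + y - y ≡ x
  cancel = solve-∀

falling-pos : ∀ n r → falling (+ n) r ≡ + (n C r) * + (r ℕ.!)
falling-pos n zero    = sym (cong (λ c → + c * + 1) (nC0≡1 n))
falling-pos n (suc r) = begin
  falling (+ n) r * (+ n - + r)          ≡⟨ cong (_* (+ n - + r)) (falling-pos n r) ⟩
  + (n C r) * + (r ℕ.!) * (+ n - + r)    ≡⟨ regroup (+ (n C r)) (+ (r ℕ.!)) (+ n - + r) ⟩
  + (r ℕ.!) * ((+ n - + r) * + (n C r))  ≡⟨ cong (+ (r ℕ.!) *_) ([n-k]*nCk≡[k+1]*nC[k+1] n r) ⟩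
  + (r ℕ.!) * (+ suc r * + (n C suc r))  ≡⟨ regroup′ (+ (r ℕ.!)) (+ suc r) (+ (n C suc r)) ⟩
  + (n C suc r) * (+ suc r * + (r ℕ.!))  ≡⟨ cong (+ (n C suc r) *_) (pos-* (suc r) (r ℕ.!)) ⟨
  + (n C suc r) * + (suc r ℕ.!)          ∎
  where
  regroup : ∀ c f d → c * f * d ≡ f * (d * c)
  regroup = solve-∀
  regroup′ : ∀ f s c → f * (s * c) ≡ c * (s * f)
  regroup′ = solve-∀

binom-pos : ∀ n r → binom (+ n) r ≡ + (n C r)
binom-pos n r = trans (cong (_/ℕ (r ℕ.!)) (falling-pos n r)) (i*n/ℕn≡i (+ (n C r)) (r ℕ.!))
  where instance _ = r ℕ.!≢0

falling-[-1] : ∀ r → falling -1ℤ r ≡ -1ℤ ^ r * + (r ℕ.!)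
falling-[-1] zero    = refl
falling-[-1] (suc r) = begin
  falling -1ℤ r * (-1ℤ - + r)            ≡⟨ cong₂ _*_ (falling-[-1] r) (-1-n≡-[1+n] r) ⟩
  -1ℤ ^ r * + (r ℕ.!) * - + suc r        ≡⟨ regroup (-1ℤ ^ r) (+ (r ℕ.!)) (+ suc r) ⟩
  -1ℤ * -1ℤ ^ r * (+ suc r * + (r ℕ.!))  ≡⟨ cong (-1ℤ * -1ℤ ^ r *_) (pos-* (suc r) (r ℕ.!)) ⟨
  -1ℤ ^ suc r * + (suc r ℕ.!)            ∎
  where
  -1-n≡-[1+n] : ∀ n → -1ℤ - + n ≡ - + suc n
  -1-n≡-[1+n] zero    = refl
  -1-n≡-[1+n] (suc n) = refl
  regroup : ∀ x f s → x * f * - s ≡ -1ℤ * x * (s * f)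
  regroup = solve-∀

binom-[-1] : ∀ r → binom -1ℤ r ≡ -1ℤ ^ r
binom-[-1] r = trans (cong (_/ℕ (r ℕ.!)) (falling-[-1] r)) (i*n/ℕn≡i (-1ℤ ^ r) (r ℕ.!))
  where instance _ = r ℕ.!≢0

w1[0,ℓ]≡[-1]^ℓ : ∀ ℓ → w1 0 ℓ ≡ -1ℤ ^ ℓ
w1[0,ℓ]≡[-1]^ℓ ℓ = begin
  binom -1ℤ ℓ * binom (+ suc ℓ) (suc ℓ) - binom (+ 0) (suc ℓ) * binom (+ suc ℓ) ℓ
    ≡⟨ cong₂ (λ x y → x * y - binom (+ 0) (suc ℓ) * binom (+ suc ℓ) ℓ) (binom-[-1] ℓ) [ℓ+1]C[ℓ+1]≡1 ⟩
  -1ℤ ^ ℓ * + 1 - binom (+ 0) (suc ℓ) * binom (+ suc ℓ) ℓ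
    ≡⟨ cong (λ x → -1ℤ ^ ℓ * + 1 - x * binom (+ suc ℓ) ℓ) (binom-pos 0 (suc ℓ)) ⟩
  -1ℤ ^ ℓ * + 1 - + 0 * binom (+ suc ℓ) ℓ
    ≡⟨ simplify (-1ℤ ^ ℓ) (binom (+ suc ℓ) ℓ) ⟩
  -1ℤ ^ ℓ ∎
  where
  [ℓ+1]C[ℓ+1]≡1 : binom (+ suc ℓ) (suc ℓ) ≡ + 1
  [ℓ+1]C[ℓ+1]≡1 = trans (binom-pos (suc ℓ) (suc ℓ)) (cong +_ (nCn≡1 (suc ℓ)))
  simplify : ∀ x y → x * + 1 - + 0 * y ≡ x
  simplify = solve-∀

w1-closed-form : ∀ m k → + suc k * w1 (suc m) k ≡ + wNumerator m k
w1-closed-form m k = begin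
  + suc k * w1 (suc m) k
    ≡⟨ cong (+ suc k *_) (cong₂ _-_ (cong₂ _*_ (binom-pos m k) (binom-pos N (suc k)))
                                    (cong₂ _*_ (binom-pos (suc m) (suc k)) (binom-pos N k))) ⟩
  + suc k * (+ a * + b - + c * + d)
    ≡⟨ distrib (+ suc k) (+ a * + b) (+ c * + d) ⟩
  + suc k * (+ a * + b) - + suc k * (+ c * + d)
    ≡⟨ cong₂ _-_ (pos-*³ (suc k) a b) (pos-*³ (suc k) c d) ⟨
  + (suc k ℕ.* (a ℕ.* b)) - + (suc k ℕ.* (c ℕ.* d))
    ≡⟨ cong (λ x → + x - + (suc k ℕ.* (c ℕ.* d))) (wNumerator-split m k) ⟩
  + (suc k ℕ.* (c ℕ.* d) ℕ.+ wNumerator m k) - + (suc k ℕ.* (c ℕ.* d))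
    ≡⟨ cong (_- + (suc k ℕ.* (c ℕ.* d))) (pos-+ (suc k ℕ.* (c ℕ.* d)) (wNumerator m k)) ⟩
  + (suc k ℕ.* (c ℕ.* d)) + + wNumerator m k - + (suc k ℕ.* (c ℕ.* d))
    ≡⟨ cancel (+ (suc k ℕ.* (c ℕ.* d))) (+ wNumerator m k) ⟩
  + wNumerator m k ∎
  where
  N = suc m ℕ.+ suc k
  a = m C k
  b = N C suc k
  c = suc m C suc k
  d = N C k
  pos-*³ : ∀ x y z → + (x ℕ.* (y ℕ.* z)) ≡ + x * (+ y * + z)
  pos-*³ x y z = trans (pos-* x (y ℕ.* z)) (cong (+ x *_) (pos-* y z))
  distrib : ∀ s x y → s * (x - y) ≡ s * x - s * y
  distrib = solve-∀
  cancel : ∀ x y → x + y - x ≡ y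
  cancel = solve-∀

w1-pair : ∀ m j → + (2 ℕ.+ j) * (w1 (suc m) j + w1 (suc m) (suc j))
                ≡ + ((suc m C suc j) ℕ.* ((suc m ℕ.+ suc j) C suc j))
w1-pair m j = *-cancelˡ-≡ (+ suc j) _ _ (begin
  + suc j * (+ (2 ℕ.+ j) * (x + y))
    ≡⟨ regroup (+ suc j) (+ (2 ℕ.+ j)) x y ⟩
  + (2 ℕ.+ j) * (+ suc j * x) + + suc j * (+ (2 ℕ.+ j) * y)
    ≡⟨ cong₂ (λ u v → + (2 ℕ.+ j) * u + + suc j * v) (w1-closed-form m j) (w1-closed-form m (suc j)) ⟩
  + (2 ℕ.+ j) * + wNumerator m j + + suc j * + wNumerator m (suc j)
    ≡⟨ cong₂ _+_ (pos-* (2 ℕ.+ j) (wNumerator m j)) (pos-* (suc j) (wNumerator m (suc j))) ⟨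
  + ((2 ℕ.+ j) ℕ.* wNumerator m j) + + (suc j ℕ.* wNumerator m (suc j))
    ≡⟨ pos-+ ((2 ℕ.+ j) ℕ.* wNumerator m j) (suc j ℕ.* wNumerator m (suc j)) ⟨
  + ((2 ℕ.+ j) ℕ.* wNumerator m j ℕ.+ suc j ℕ.* wNumerator m (suc j))
    ≡⟨ cong +_ (wNumerator-pair m j) ⟩
  + (suc j ℕ.* R)
    ≡⟨ pos-* (suc j) R ⟩
  + suc j * + R ∎)
  where
  x = w1 (suc m) j
  y = w1 (suc m) (suc j)
  R = (suc m C suc j) ℕ.* ((suc m ℕ.+ suc j) C suc j)
  regroup : ∀ s t x y → s * (t * (x + y)) ≡ t * (s * x) + s * (t * y)
  regroup = solve-∀

2∣[2b+1]*i⇒2∣i : ∀ b i → + 2 ∣ + suc (2 ℕ.* b) * i → + 2 ∣ i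
2∣[2b+1]*i⇒2∣i b i 2∣[2b+1]*i =
  ∣m+n∣n⇒∣m (subst (+ 2 ∣_) split 2∣[2b+1]*i) (divides (+ b * i) refl)
  where
  split : + suc (2 ℕ.* b) * i ≡ i + + b * i * + 2
  split = begin
    + suc (2 ℕ.* b) * i   ≡⟨ cong (_* i) (trans (pos-+ 1 (2 ℕ.* b)) (cong (_+_ 1ℤ) (pos-* 2 b))) ⟩
    (1ℤ + + 2 * + b) * i  ≡⟨ regroup (+ b) i ⟩
    i + + b * i * + 2     ∎
    where
    regroup : ∀ b i → (+ 1 + + 2 * b) * i ≡ i + b * i * + 2
    regroup = solve-∀

w1[n,0]≡1 : ∀ n → w1 n 0 ≡ + 1
w1[n,0]≡1 zero    = refl
w1[n,0]≡1 (suc m) = trans (sym (*-identityˡ (w1 (suc m) 0))) (w1-closed-form m 0)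

2∣w1[n,2b+1]+w1[n,2b+2] : ∀ n b → + 2 ∣ w1 n (suc (2 ℕ.* b)) + w1 n (suc (suc (2 ℕ.* b)))
2∣w1[n,2b+1]+w1[n,2b+2] zero b = divides (+ 0) (begin
  w1 0 j + w1 0 (suc j)    ≡⟨ cong₂ _+_ (w1[0,ℓ]≡[-1]^ℓ j) (w1[0,ℓ]≡[-1]^ℓ (suc j)) ⟩
  -1ℤ ^ j + -1ℤ * -1ℤ ^ j  ≡⟨ cancel (-1ℤ ^ j) ⟩
  + 0                      ∎)
  where
  j = suc (2 ℕ.* b)
  cancel : ∀ x → x + -1ℤ * x ≡ + 0
  cancel = solve-∀
2∣w1[n,2b+1]+w1[n,2b+2] (suc m) b =
  2∣[2b+1]*i⇒2∣i (suc b) pair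
    (subst (+ 2 ∣_) (sym scaled-pair) (∣ᵤ⇒∣ (2∣nC[k+1]*[n+k+1]C[k+1] (suc m) j)))
  where
  j = suc (2 ℕ.* b)
  pair = w1 (suc m) j + w1 (suc m) (suc j)
  scaled-pair : + suc (2 ℕ.* suc b) * pair
              ≡ + ((suc m C suc j) ℕ.* ((suc m ℕ.+ suc j) C suc j))
  scaled-pair = trans (cong (λ k → + suc k * pair) (ℕ.*-suc 2 b)) (w1-pair m j)

2∣sumTo[2b]w1-1 : ∀ n b → + 2 ∣ sumTo (2 ℕ.* b) (w1 n) - + 1
2∣sumTo[2b]w1-1 n zero    = divides (+ 0) (cong (_- + 1) (w1[n,0]≡1 n))
2∣sumTo[2b]w1-1 n (suc b) = subst (λ k → + 2 ∣ sumTo k (w1 n) - + 1) (sym (ℕ.*-suc 2 b))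
  (subst (+ 2 ∣_) (regroup S _ _) (∣m∣n⇒∣m+n (2∣sumTo[2b]w1-1 n b) (2∣w1[n,2b+1]+w1[n,2b+2] n b)))
  where
  S = sumTo (2 ℕ.* b) (w1 n)
  regroup : ∀ s x y → s - + 1 + (x + y) ≡ s + x + y - + 1
  regroup = solve-∀

sumTo-distrib-+ : ∀ k f g → sumTo k (λ ℓ → f ℓ + g ℓ) ≡ sumTo k f + sumTo k g
sumTo-distrib-+ zero    f g = refl
sumTo-distrib-+ (suc k) f g = begin
  sumTo k (λ ℓ → f ℓ + g ℓ) + (f (suc k) + g (suc k)) ≡⟨ cong (_+ (f (suc k) + g (suc k))) (sumTo-distrib-+ k f g) ⟩
  sumTo k f + sumTo k g + (f (suc k) + g (suc k))     ≡⟨ interchange (sumTo k f) (sumTo k g) (f (suc k)) (g (suc k)) ⟩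
  sumTo k f + f (suc k) + (sumTo k g + g (suc k))     ∎
  where
  interchange : ∀ a b c d → a + b + (c + d) ≡ a + c + (b + d)
  interchange = solve-∀

2∣sumTo[2b]H : ∀ n b → + 2 ∣ sumTo (2 ℕ.* b) (H n)
2∣sumTo[2b]H n b = subst (+ 2 ∣_) (trans (regroup S T) (sym (sumTo-distrib-+ (2 ℕ.* b) (w1 n) (w1 (suc n)))))
  (∣m∣n⇒∣m+n (∣m∣n⇒∣m+n (2∣sumTo[2b]w1-1 n b) (2∣sumTo[2b]w1-1 (suc n) b)) (divides (+ 1) refl))
  where
  S = sumTo (2 ℕ.* b) (w1 n)
  T = sumTo (2 ℕ.* b) (w1 (suc n))
  regroup : ∀ s t → s - + 1 + (t - + 1) + + 2 ≡ s + t
  regroup = solve-∀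

lemma3p5 : (n b : ℕ) →
    ((+ 2) Unsigned.∣ (sumTo (2 ℕ.* b) (w1 n) - + 1))
    × ((+ 2) Unsigned.∣ sumTo (2 ℕ.* b) (H n))
lemma3p5 n b = ∣⇒∣ᵤ (2∣sumTo[2b]w1-1 n b) , ∣⇒∣ᵤ (2∣sumTo[2b]H n b)
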